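{- Define polynomials $p_n(x,y,z)$ by \[ \sum_{n=0}^\infty p_n(x,y,z)q^n=\prod_{j=0}^\infty\left(1+xq^{2^j}\right)\left(1+yq^{2^j}+zq^{2\cdot 2^j}\right), \] and for $n\ge 0$ set $Q_n(x,y,z)=p_{2^{n+1}-2}(x,y,z)$ and $R_n(x,y,z)=p_{2^n-1}(x,y,z)$. Then \begin{align*} \sum_{n=0}^{\infty}Q_n(x,y,z)q^n&=\frac{1}{1-(xy+x+y+z)q+(x^2y+xy^2+yz)q^2},\\ \sum_{n=0}^{\infty}R_n(x,y,z)q^n&=\frac{1-(xy+z)q}{1-(xy+x+y+z)q+(x^2y+xy^2+yz)q^2}. \end{align*} -}

module Defs where

open import Level using (Level)
open import Algebra.Bundles using (CommutativeRing)
open import Data.Nat as ℕ using (ℕ; zero; suc; _∸_; _^_)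
open import Relation.Nullary using (yes; no)

-- A polynomial identity in
-- ℤ[x,y,z] is stated as holding for all x y z in every commutative ring
-- (equivalent to the identity in ℤ[x,y,z] by taking R = ℤ[x,y,z]).
module PS {c ℓ : Level} (R : CommutativeRing c ℓ) where
  open CommutativeRing R using (Carrier; _+_; _*_; -_; 0#; 1#)

  Series : Set c
  Series = ℕ → Carrier

  sumTo : (ℕ → Carrier) → ℕ → Carrier
  sumTo f zero    = f zero
  sumTo f (suc n) = sumTo f n + f (suc n)

  _⊛_ : Series → Series → Series
  (f ⊛ g) n = sumTo (λ k → f k * g (n ∸ k)) n

  _⊕_ : Series → Series → Series
  (f ⊕ g) n = f n + g n

  mono : Carrier → ℕ → Series
  mono a m n with m ℕ.≟ n
  ... | yes _ = a
  ... | no  _ = 0#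

  one : Series
  one = mono 1# 0

  module Gen (x y z : Carrier) where

    factor : ℕ → Series
    factor j = (one ⊕ mono x (2 ^ j)) ⊛ (one ⊕ (mono y (2 ^ j) ⊕ mono z (2 ℕ.* 2 ^ j)))

    partialProd : ℕ → Series
    partialProd zero    = one
    partialProd (suc m) = partialProd m ⊛ factor m

    -- Every factor with
    -- j ≥ n+1 is 1 + O(q^{2^j}) with 2^j > n, so the coefficient of q^n in
    -- the infinite product equals that of the finite product over j ≤ n.
    p : ℕ → Carrier
    p n = partialProd (suc n) n

    Q : ℕ → Carrier
    Q n = p (2 ^ (suc n) ∸ 2)

    Rs : ℕ → Carrier
    Rs n = p (2 ^ n ∸ 1)

    Den : Series
    Den = one ⊕ (mono (- (x * y + x + y + z)) 1
                 ⊕ mono (x * x * y + x * y * y + y * z) 2)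

    NumR : Series
    NumR = one ⊕ mono (- (x * y + z)) 1

module Submission where

open import Defs
open import Level using (Level)
open import Algebra.Bundles using (CommutativeRing)
open import Data.Nat using (ℕ; zero; suc; _∸_; _^_; _≤_; _<_; _≤′_; ≤′-refl; ≤′-step; z≤n; s≤s)
import Data.Nat as ℕ
open import Data.Nat.Properties
  using (≤-refl; ≤-trans; n≤1+n; m≤n⇒m≤1+n; m∸n≤m; n∸n≡0; +-∸-assoc; ∸-+-assoc; m+[n∸m]≡n; *-suc; m^n>0; ≤⇒≤′; ≤′⇒≤)
open import Data.Product using (_×_; _,_)
open import Data.Empty using (⊥-elim)
open import Function using (_∘_)
open import Relation.Nullary using (Dec; yes; no)
import Relation.Binary.PropositionalEquality as ≡
open ≡ using (_≡_; _≢_)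

-- Writing F(q) = ∏_{j≥0} f(q^{2^j}) with f(q) = (1 + xq)(1 + yq + zq²) = 1 + a₁q + a₂q² + a₃q³,
-- one has F(q) = f(q) F(q²).  Comparing even and odd coefficients gives
--   p_{2k} = p_k + a₂ p_{k-1},   p_{2k+1} = a₁ p_k + a₃ p_{k-1}.
-- Since 2^{n+1} - 2 = 2(2^n - 1) and 2^{n+1} - 1 = 2(2^n - 1) + 1, the pair (R_n, Q_{n-1})
-- evolves by the matrix [[a₁, a₃], [1, a₂]], whose trace is xy+x+y+z and whose determinant
-- is x²y+xy²+yz.  By Cayley–Hamilton both R and Q satisfy the recurrence with this
-- characteristic polynomial, which is exactly the denominator; the numerators are read off
-- from the first two terms.

double : ℕ → ℕ
double zero    = zero
double (suc n) = suc (suc (double n))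

data Parity : ℕ → Set where
  even : ∀ k → Parity (double k)
  odd  : ∀ k → Parity (suc (double k))

parity : ∀ n → Parity n
parity zero = even 0
parity (suc n) with parity n
... | even k = odd k
... | odd k  = even (suc k)

double≡2* : ∀ n → double n ≡ 2 ℕ.* n
double≡2* zero    = ≡.refl
double≡2* (suc n) = ≡.trans (≡.cong (suc ∘ suc) (double≡2* n)) (≡.sym (*-suc 2 n))

n≤double : ∀ n → n ≤ double n
n≤double zero    = z≤n
n≤double (suc n) = s≤s (m≤n⇒m≤1+n (n≤double n))

double-∸ : ∀ m n → double m ∸ double n ≡ double (m ∸ n)
double-∸ zero    zero    = ≡.refl
double-∸ zero    (suc n) = ≡.refl
double-∸ (suc m) zero    = ≡.refl
double-∸ (suc m) (suc n) = double-∸ m n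

suc-double-∸ : ∀ {m n} → n ≤ m → suc (double m) ∸ double n ≡ suc (double (m ∸ n))
suc-double-∸ z≤n       = ≡.refl
suc-double-∸ (s≤s n≤m) = suc-double-∸ n≤m

2^suc≡2+double : ∀ n → 2 ^ suc n ≡ 2 ℕ.+ double (2 ^ n ∸ 1)
2^suc≡2+double n = go (m^n>0 2 n)
  where
  go : ∀ {m} → 0 < m → 2 ℕ.* m ≡ 2 ℕ.+ double (m ∸ 1)
  go {suc m} _ = ≡.sym (double≡2* (suc m))

module PowerSeries {c ℓ : Level} (R : CommutativeRing c ℓ) where
  open CommutativeRing R hiding (zero)
  open PS R
  open import Algebra.Properties.Ring ring using (-‿distribˡ-*)
  open import Algebra.Properties.CommutativeSemigroup +-commutativeSemigroup
    using () renaming (interchange to +-interchange)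
  open import Algebra.Solver.Ring.NaturalCoefficients.Default commutativeSemiring
    using (solve; _:=_; _:+_; _:*_; con)
  open import Relation.Binary.Reasoning.Setoid setoid

  infix 4 _≋_
  _≋_ : Series → Series → Set ℓ
  f ≋ g = ∀ n → f n ≈ g n

  sumTo-cong : ∀ {f g} n → (∀ i → i ≤ n → f i ≈ g i) → sumTo f n ≈ sumTo g n
  sumTo-cong zero    f≈g = f≈g 0 z≤n
  sumTo-cong (suc n) f≈g =
    +-cong (sumTo-cong n (λ i i≤n → f≈g i (m≤n⇒m≤1+n i≤n))) (f≈g (suc n) ≤-refl)

  sumTo-zero : ∀ {f} n → (∀ i → i ≤ n → f i ≈ 0#) → sumTo f n ≈ 0#
  sumTo-zero zero    f≈0 = f≈0 0 z≤n
  sumTo-zero (suc n) f≈0 =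
    trans (+-cong (sumTo-zero n (λ i i≤n → f≈0 i (m≤n⇒m≤1+n i≤n))) (f≈0 (suc n) ≤-refl))
          (+-identityʳ 0#)

  sumTo-+ : ∀ f g n → sumTo (λ i → f i + g i) n ≈ sumTo f n + sumTo g n
  sumTo-+ f g zero    = refl
  sumTo-+ f g (suc n) = trans (+-congʳ (sumTo-+ f g n)) (+-interchange _ _ _ _)

  *-distribˡ-sumTo : ∀ a f n → a * sumTo f n ≈ sumTo (λ i → a * f i) n
  *-distribˡ-sumTo a f zero    = refl
  *-distribˡ-sumTo a f (suc n) = trans (distribˡ a _ _) (+-congʳ (*-distribˡ-sumTo a f n))

  *-distribʳ-sumTo : ∀ a f n → sumTo f n * a ≈ sumTo (λ i → f i * a) n
  *-distribʳ-sumTo a f zero    = refl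
  *-distribʳ-sumTo a f (suc n) = trans (distribʳ a _ _) (+-congʳ (*-distribʳ-sumTo a f n))

  sumTo-suc : ∀ f n → sumTo f (suc n) ≈ f 0 + sumTo (f ∘ suc) n
  sumTo-suc f zero    = refl
  sumTo-suc f (suc n) = trans (+-congʳ (sumTo-suc f n)) (+-assoc _ _ _)

  -- Both sides sum W i j over the triangle i + j ≤ n.
  sumTo-triangle : ∀ (W : ℕ → ℕ → Carrier) n →
    sumTo (λ k → sumTo (λ i → W i (k ∸ i)) k) n ≈ sumTo (λ i → sumTo (W i) (n ∸ i)) n
  sumTo-triangle W zero    = refl
  sumTo-triangle W (suc n) = begin
    sumTo (λ k → sumTo (λ i → W i (k ∸ i)) k) n + sumTo (λ i → W i (suc n ∸ i)) (suc n)
      ≈⟨ +-congʳ (sumTo-triangle W n) ⟩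
    sumTo (λ i → sumTo (W i) (n ∸ i)) n + (sumTo (λ i → W i (suc n ∸ i)) n + W (suc n) (n ∸ n))
      ≈⟨ +-assoc _ _ _ ⟨
    (sumTo (λ i → sumTo (W i) (n ∸ i)) n + sumTo (λ i → W i (suc n ∸ i)) n) + W (suc n) (n ∸ n)
      ≈⟨ +-congʳ (sumTo-+ _ _ n) ⟨
    sumTo (λ i → sumTo (W i) (n ∸ i) + W i (suc n ∸ i)) n + W (suc n) (n ∸ n)
      ≈⟨ +-cong (sumTo-cong n extend) last ⟨
    sumTo (λ i → sumTo (W i) (suc n ∸ i)) n + sumTo (W (suc n)) (n ∸ n) ∎
    where
    last : sumTo (W (suc n)) (n ∸ n) ≈ W (suc n) (n ∸ n)
    last rewrite n∸n≡0 n = refl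
    extend : ∀ i → i ≤ n → sumTo (W i) (suc n ∸ i) ≈ sumTo (W i) (n ∸ i) + W i (suc n ∸ i)
    extend i i≤n rewrite +-∸-assoc 1 i≤n = refl

  sumTo-double : ∀ h k → (∀ j → h (suc (double j)) ≈ 0#) →
                 sumTo h (double k) ≈ sumTo (h ∘ double) k
  sumTo-double h zero    h-odd = refl
  sumTo-double h (suc k) h-odd =
    +-congʳ (trans (+-cong (sumTo-double h k h-odd) (h-odd k)) (+-identityʳ _))

  ⊛-cong : ∀ {f f′ g g′} → f ≋ f′ → g ≋ g′ → f ⊛ g ≋ f′ ⊛ g′
  ⊛-cong f≋f′ g≋g′ n = sumTo-cong n (λ k _ → *-cong (f≋f′ k) (g≋g′ (n ∸ k)))

  ⊛-congˡ-≤ : ∀ f {g g′} n → (∀ k → k ≤ n → g k ≈ g′ k) → (f ⊛ g) n ≈ (f ⊛ g′) n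
  ⊛-congˡ-≤ f n g≈g′ = sumTo-cong n (λ k _ → *-congˡ (g≈g′ (n ∸ k) (m∸n≤m n k)))

  ⊛-assoc : ∀ f g h → (f ⊛ g) ⊛ h ≋ f ⊛ (g ⊛ h)
  ⊛-assoc f g h n = begin
    ((f ⊛ g) ⊛ h) n
      ≈⟨ sumTo-cong n (λ k _ → trans (*-distribʳ-sumTo _ _ k) (sumTo-cong k (λ i i≤k →
           reflexive (≡.cong (λ t → f i * g (k ∸ i) * h (n ∸ t)) (≡.sym (m+[n∸m]≡n i≤k)))))) ⟩
    sumTo (λ k → sumTo (λ i → W i (k ∸ i)) k) n
      ≈⟨ sumTo-triangle W n ⟩
    sumTo (λ i → sumTo (W i) (n ∸ i)) n
      ≈⟨ sumTo-cong n (λ i _ → trans (sumTo-cong (n ∸ i) (λ j _ →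
           trans (*-assoc _ _ _) (*-congˡ (*-congˡ (reflexive (≡.cong h (≡.sym (∸-+-assoc n i j))))))))
           (sym (*-distribˡ-sumTo (f i) _ (n ∸ i)))) ⟩
    (f ⊛ (g ⊛ h)) n ∎
    where
    W : ℕ → ℕ → Carrier
    W i j = f i * g j * h (n ∸ (i ℕ.+ j))

  ⊛-distribʳ-⊕ : ∀ f g h → (f ⊕ g) ⊛ h ≋ (f ⊛ h) ⊕ (g ⊛ h)
  ⊛-distribʳ-⊕ f g h n = trans (sumTo-cong n (λ k _ → distribʳ (h (n ∸ k)) (f k) (g k))) (sumTo-+ _ _ n)

  mono-same : ∀ a m → mono a m m ≡ a
  mono-same a m with m ℕ.≟ m
  ... | yes _   = ≡.refl
  ... | no m≢m = ⊥-elim (m≢m ≡.refl)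

  mono-other : ∀ a {m n} → m ≢ n → mono a m n ≡ 0#
  mono-other a {m} {n} m≢n with m ℕ.≟ n
  ... | yes m≡n = ⊥-elim (m≢n m≡n)
  ... | no _    = ≡.refl

  mono-suc : ∀ a m n → mono a (suc m) (suc n) ≡ mono a m n
  mono-suc a m n = by-cases (m ℕ.≟ n)
    where
    by-cases : Dec (m ≡ n) → mono a (suc m) (suc n) ≡ mono a m n
    by-cases (yes ≡.refl) = ≡.trans (mono-same a (suc m)) (≡.sym (mono-same a m))
    by-cases (no m≢n)     = ≡.trans (mono-other a {suc m} {suc n} (m≢n ∘ ≡.cong ℕ.pred)) (≡.sym (mono-other a m≢n))

  shift : Series → Series
  shift f zero    = 0#
  shift f (suc n) = f n

  shift-cong : ∀ {f g} → f ≋ g → shift f ≋ shift g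
  shift-cong f≋g zero    = refl
  shift-cong f≋g (suc n) = f≋g n

  shift-*ˡ : ∀ a f → shift (λ n → a * f n) ≋ (λ n → a * shift f n)
  shift-*ˡ a f zero    = sym (zeroʳ a)
  shift-*ˡ a f (suc n) = refl

  mono₀-⊛ : ∀ a h → mono a 0 ⊛ h ≋ (λ n → a * h n)
  mono₀-⊛ a h zero    = refl
  mono₀-⊛ a h (suc n) = begin
    (mono a 0 ⊛ h) (suc n)                      ≈⟨ sumTo-suc _ n ⟩
    a * h (suc n) + sumTo (λ k → 0# * h (n ∸ k)) n ≈⟨ +-congˡ (sumTo-zero n (λ k _ → zeroˡ _)) ⟩
    a * h (suc n) + 0#                           ≈⟨ +-identityʳ _ ⟩
    a * h (suc n) ∎

  mono-suc-⊛ : ∀ a m h → mono a (suc m) ⊛ h ≋ shift (mono a m ⊛ h)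
  mono-suc-⊛ a m h zero    = zeroˡ (h 0)
  mono-suc-⊛ a m h (suc n) = begin
    (mono a (suc m) ⊛ h) (suc n)
      ≈⟨ sumTo-suc _ n ⟩
    0# * h (suc n) + sumTo (λ k → mono a (suc m) (suc k) * h (n ∸ k)) n
      ≈⟨ +-cong (zeroˡ _) (sumTo-cong n (λ k _ → *-congʳ (reflexive (mono-suc a m k)))) ⟩
    0# + (mono a m ⊛ h) n
      ≈⟨ +-identityˡ _ ⟩
    (mono a m ⊛ h) n ∎

  ⊛-identityˡ : ∀ h → one ⊛ h ≋ h
  ⊛-identityˡ h n = trans (mono₀-⊛ 1# h n) (*-identityˡ (h n))

  ⊛-identityʳ : ∀ f → f ⊛ one ≋ f
  ⊛-identityʳ f zero    = *-identityʳ (f 0)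
  ⊛-identityʳ f (suc n) = begin
    sumTo (λ k → f k * one (suc n ∸ k)) n + f (suc n) * one (n ∸ n)
      ≈⟨ +-cong (sumTo-zero n vanish) (*-congˡ (reflexive (≡.cong one (n∸n≡0 n)))) ⟩
    0# + f (suc n) * 1#
      ≈⟨ trans (+-identityˡ _) (*-identityʳ _) ⟩
    f (suc n) ∎
    where
    vanish : ∀ k → k ≤ n → f k * one (suc n ∸ k) ≈ 0#
    vanish k k≤n rewrite +-∸-assoc 1 k≤n = zeroʳ (f k)

  mono₁-⊛ : ∀ a h → mono a 1 ⊛ h ≋ (λ n → a * shift h n)
  mono₁-⊛ a h n = trans (mono-suc-⊛ a 0 h n) (trans (shift-cong (mono₀-⊛ a h) n) (shift-*ˡ a h n))

  mono₂-⊛ : ∀ a h → mono a 2 ⊛ h ≋ (λ n → a * shift (shift h) n)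
  mono₂-⊛ a h n = trans (mono-suc-⊛ a 1 h n) (trans (shift-cong (mono₁-⊛ a h) n) (shift-*ˡ a (shift h) n))

  linear-⊛ : ∀ a h → (one ⊕ mono a 1) ⊛ h ≋ (λ n → h n + a * shift h n)
  linear-⊛ a h n = trans (⊛-distribʳ-⊕ one _ h n) (+-cong (⊛-identityˡ h n) (mono₁-⊛ a h n))

  quadratic-⊛ : ∀ a b h →
    (one ⊕ (mono a 1 ⊕ mono b 2)) ⊛ h ≋ (λ n → h n + (a * shift h n + b * shift (shift h) n))
  quadratic-⊛ a b h n = trans (⊛-distribʳ-⊕ one _ h n)
    (+-cong (⊛-identityˡ h n) (trans (⊛-distribʳ-⊕ _ _ h n) (+-cong (mono₁-⊛ a h n) (mono₂-⊛ b h n))))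

  -- f(q) ↦ f(q²)
  dilate : Series → Series
  dilate f zero          = f zero
  dilate f (suc zero)    = 0#
  dilate f (suc (suc n)) = dilate (f ∘ suc) n

  dilate-double : ∀ f k → dilate f (double k) ≡ f k
  dilate-double f zero    = ≡.refl
  dilate-double f (suc k) = dilate-double (f ∘ suc) k

  dilate-suc-double : ∀ f k → dilate f (suc (double k)) ≡ 0#
  dilate-suc-double f zero    = ≡.refl
  dilate-suc-double f (suc k) = dilate-suc-double (f ∘ suc) k

  shift-dilate-double : ∀ f k → shift (dilate f) (double k) ≡ 0#
  shift-dilate-double f zero    = ≡.refl
  shift-dilate-double f (suc k) = dilate-suc-double f k

  shift²-dilate-double : ∀ f k → shift (shift (dilate f)) (double k) ≡ shift f k
  shift²-dilate-double f zero    = ≡.refl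
  shift²-dilate-double f (suc k) = dilate-double f k

  dilate-cong : ∀ {f g} → f ≋ g → dilate f ≋ dilate g
  dilate-cong f≋g zero          = f≋g 0
  dilate-cong f≋g (suc zero)    = refl
  dilate-cong f≋g (suc (suc n)) = dilate-cong (f≋g ∘ suc) n

  dilate-cong-< : ∀ {f g} N → (∀ j → j < N → f j ≈ g j) →
                  ∀ k → k < double N → dilate f k ≈ dilate g k
  dilate-cong-< (suc N) f≈g zero          _                 = f≈g 0 (s≤s z≤n)
  dilate-cong-< (suc N) f≈g (suc zero)    _                 = refl
  dilate-cong-< (suc N) f≈g (suc (suc k)) (s≤s (s≤s k<2N)) =
    dilate-cong-< N (λ j j<N → f≈g (suc j) (s≤s j<N)) k k<2N

  dilate-⊕ : ∀ f g → dilate (f ⊕ g) ≋ dilate f ⊕ dilate g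
  dilate-⊕ f g zero          = refl
  dilate-⊕ f g (suc zero)    = sym (+-identityʳ 0#)
  dilate-⊕ f g (suc (suc n)) = dilate-⊕ (f ∘ suc) (g ∘ suc) n

  dilate-mono : ∀ a m → dilate (mono a m) ≋ mono a (2 ℕ.* m)
  dilate-mono a m n = ≡.subst (λ d → dilate (mono a m) n ≈ mono a d n) (double≡2* m) (go m n)
    where
    dilate-0# : ∀ n → dilate (λ _ → 0#) n ≈ 0#
    dilate-0# zero          = refl
    dilate-0# (suc zero)    = refl
    dilate-0# (suc (suc n)) = dilate-0# n
    go : ∀ m n → dilate (mono a m) n ≈ mono a (double m) n
    go zero    zero          = refl
    go (suc m) zero          = refl
    go zero    (suc zero)    = refl
    go (suc m) (suc zero)    = refl
    go zero    (suc (suc n)) = dilate-0# n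
    go (suc m) (suc (suc n)) = begin
      dilate (mono a (suc m) ∘ suc) n          ≈⟨ dilate-cong (reflexive ∘ mono-suc a m) n ⟩
      dilate (mono a m) n                      ≈⟨ go m n ⟩
      mono a (double m) n                      ≡⟨ ≡.trans (mono-suc a (suc (double m)) (suc n)) (mono-suc a (double m) n) ⟨
      mono a (double (suc m)) (suc (suc n)) ∎

  dilate-⊛ : ∀ f g → dilate (f ⊛ g) ≋ dilate f ⊛ dilate g
  dilate-⊛ f g n = by-parity (parity n)
    where
    term : ℕ → ℕ → Carrier
    term n i = dilate f i * dilate g (n ∸ i)

    odd-vanish : ∀ n j → term n (suc (double j)) ≈ 0#
    odd-vanish n j = trans (*-congʳ (reflexive (dilate-suc-double f j))) (zeroˡ _)

    by-parity : ∀ {n} → Parity n → dilate (f ⊛ g) n ≈ (dilate f ⊛ dilate g) n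
    by-parity (even k) = begin
      dilate (f ⊛ g) (double k)
        ≡⟨ dilate-double (f ⊛ g) k ⟩
      (f ⊛ g) k
        ≈⟨ sumTo-cong k (λ i _ → reflexive (≡.cong₂ _*_ (dilate-double f i)
             (≡.trans (≡.cong (dilate g) (double-∸ k i)) (dilate-double g (k ∸ i))))) ⟨
      sumTo (term (double k) ∘ double) k
        ≈⟨ sumTo-double (term (double k)) k (odd-vanish (double k)) ⟨
      (dilate f ⊛ dilate g) (double k) ∎
    by-parity (odd k) = begin
      dilate (f ⊛ g) (suc (double k))
        ≡⟨ dilate-suc-double (f ⊛ g) k ⟩
      0#
        ≈⟨ sumTo-zero k even-vanish ⟨
      sumTo (term (suc (double k)) ∘ double) k
        ≈⟨ sumTo-double (term (suc (double k))) k (odd-vanish (suc (double k))) ⟨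
      sumTo (term (suc (double k))) (double k)
        ≈⟨ trans (+-congˡ (odd-vanish (suc (double k)) k)) (+-identityʳ _) ⟨
      (dilate f ⊛ dilate g) (suc (double k)) ∎
      where
      even-vanish : ∀ i → i ≤ k → term (suc (double k)) (double i) ≈ 0#
      even-vanish i i≤k = trans (*-congˡ (reflexive (≡.trans (≡.cong (dilate g) (suc-double-∸ i≤k))
                                                             (dilate-suc-double g (k ∸ i)))))
                                (zeroʳ _)

  coupled⇒second-order : ∀ {a b c d e} (r s : ℕ → Carrier) → e + b * c ≈ a * d →
    (∀ n → r (suc n) ≈ a * r n + b * s n) →
    (∀ n → s (suc n) ≈ c * r n + d * s n) →
    ∀ n → r (suc (suc n)) + e * r n ≈ (a + d) * r (suc n)
  coupled⇒second-order {a} {b} {c} {d} {e} r s det r-step s-step n = begin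
    r (suc (suc n)) + e * r n
      ≈⟨ +-congʳ (trans (r-step (suc n)) (+-congˡ (*-congˡ (s-step n)))) ⟩
    a * r (suc n) + b * (c * r n + d * s n) + e * r n
      ≈⟨ solve 8 (λ a b c d e r₁ r₀ s₀ →
           a :* r₁ :+ b :* (c :* r₀ :+ d :* s₀) :+ e :* r₀
             := a :* r₁ :+ (e :+ b :* c) :* r₀ :+ d :* (b :* s₀)) refl a b c d e (r (suc n)) (r n) (s n) ⟩
    a * r (suc n) + (e + b * c) * r n + d * (b * s n)
      ≈⟨ +-congʳ (+-congˡ (*-congʳ det)) ⟩
    a * r (suc n) + a * d * r n + d * (b * s n)
      ≈⟨ solve 6 (λ a b d r₁ r₀ s₀ →
           a :* r₁ :+ a :* d :* r₀ :+ d :* (b :* s₀) := a :* r₁ :+ d :* (a :* r₀ :+ b :* s₀))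
           refl a b d (r (suc n)) (r n) (s n) ⟩
    a * r (suc n) + d * (a * r n + b * s n)
      ≈⟨ +-congˡ (*-congˡ (r-step n)) ⟨
    a * r (suc n) + d * r (suc n)
      ≈⟨ distribʳ _ _ _ ⟨
    (a + d) * r (suc n) ∎

  u+w≈cv+t⇒u+[-cv+w]≈t : ∀ {u w c v t} → u + w ≈ c * v + t → u + (- c * v + w) ≈ t
  u+w≈cv+t⇒u+[-cv+w]≈t {u} {w} {c} {v} {t} eq = begin
    u + (- c * v + w)      ≈⟨ +-congˡ (+-congʳ (-‿distribˡ-* c v)) ⟨
    u + (- (c * v) + w)    ≈⟨ solve 3 (λ u w m → u :+ (m :+ w) := (u :+ w) :+ m) refl u w (- (c * v)) ⟩
    u + w + - (c * v)      ≈⟨ +-congʳ eq ⟩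
    c * v + t + - (c * v)  ≈⟨ solve 3 (λ p t m → p :+ t :+ m := t :+ (p :+ m)) refl (c * v) t (- (c * v)) ⟩
    t + (c * v + - (c * v)) ≈⟨ +-congˡ (-‿inverseʳ (c * v)) ⟩
    t + 0#                 ≈⟨ +-identityʳ t ⟩
    t ∎

  module Generating (x y z : Carrier) where
    open Gen x y z

    a₁ a₂ a₃ c₁ c₂ : Carrier
    a₁ = x + y
    a₂ = x * y + z
    a₃ = x * z
    c₁ = x * y + x + y + z
    c₂ = x * x * y + x * y * y + y * z

    cubic : Carrier → Carrier → Carrier → Carrier → Carrier
    cubic u v w t = u + a₁ * v + a₂ * w + a₃ * t

    cubic-≡ : ∀ {u u′ v v′ w w′ t t′} → u ≡ u′ → v ≡ v′ → w ≡ w′ → t ≡ t′ →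
              cubic u v w t ≡ cubic u′ v′ w′ t′
    cubic-≡ ≡.refl ≡.refl ≡.refl ≡.refl = ≡.refl

    factor₀-⊛ : ∀ h n → (factor 0 ⊛ h) n ≈
                cubic (h n) (shift h n) (shift (shift h) n) (shift (shift (shift h)) n)
    factor₀-⊛ h n = begin
      (factor 0 ⊛ h) n                 ≈⟨ ⊛-assoc (one ⊕ mono x 1) _ h n ⟩
      ((one ⊕ mono x 1) ⊛ g) n          ≈⟨ linear-⊛ x g n ⟩
      g n + x * shift g n               ≈⟨ +-cong (quadratic-⊛ y z h n) (*-congˡ (shift-cong (quadratic-⊛ y z h) n)) ⟩
      g′ n + x * shift g′ n             ≈⟨ expand n ⟩
      cubic (h n) (shift h n) (shift (shift h) n) (shift (shift (shift h)) n) ∎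
      where
      g g′ : Series
      g = (one ⊕ (mono y 1 ⊕ mono z 2)) ⊛ h
      g′ k = h k + (y * shift h k + z * shift (shift h) k)
      expand : ∀ n → g′ n + x * shift g′ n ≈
               cubic (h n) (shift h n) (shift (shift h) n) (shift (shift (shift h)) n)
      expand zero = solve 4 (λ h₀ x y z →
        h₀ :+ (y :* con 0 :+ z :* con 0) :+ x :* con 0
          := h₀ :+ (x :+ y) :* con 0 :+ (x :* y :+ z) :* con 0 :+ (x :* z) :* con 0) refl (h 0) x y z
      expand (suc n) = solve 7 (λ h₁ h₀ h₋₁ h₋₂ x y z →
        h₁ :+ (y :* h₀ :+ z :* h₋₁) :+ x :* (h₀ :+ (y :* h₋₁ :+ z :* h₋₂))
          := h₁ :+ (x :+ y) :* h₀ :+ (x :* y :+ z) :* h₋₁ :+ (x :* z) :* h₋₂)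
        refl (h (suc n)) (h n) (shift h n) (shift (shift h) n) x y z

    factor₀-⊛-dilate-even : ∀ S k → (factor 0 ⊛ dilate S) (double k) ≈ S k + a₂ * shift S k
    factor₀-⊛-dilate-even S k = begin
      (factor 0 ⊛ dilate S) (double k)
        ≈⟨ factor₀-⊛ (dilate S) (double k) ⟩
      cubic (dilate S (double k)) (shift (dilate S) (double k))
            (shift (shift (dilate S)) (double k)) (shift (shift (shift (dilate S))) (double k))
        ≡⟨ cubic-≡ (dilate-double S k) (shift-dilate-double S k) (shift²-dilate-double S k) (shift³ k) ⟩
      cubic (S k) 0# (shift S k) 0#
        ≈⟨ solve 5 (λ s s₋₁ x y z →
             s :+ (x :+ y) :* con 0 :+ (x :* y :+ z) :* s₋₁ :+ (x :* z) :* con 0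
               := s :+ (x :* y :+ z) :* s₋₁) refl (S k) (shift S k) x y z ⟩
      S k + a₂ * shift S k ∎
      where
      shift³ : ∀ k → shift (shift (shift (dilate S))) (double k) ≡ 0#
      shift³ zero    = ≡.refl
      shift³ (suc k) = shift-dilate-double S k

    factor₀-⊛-dilate-odd : ∀ S k → (factor 0 ⊛ dilate S) (suc (double k)) ≈ a₁ * S k + a₃ * shift S k
    factor₀-⊛-dilate-odd S k = begin
      (factor 0 ⊛ dilate S) (suc (double k))
        ≈⟨ factor₀-⊛ (dilate S) (suc (double k)) ⟩
      cubic (dilate S (suc (double k))) (dilate S (double k))
            (shift (dilate S) (double k)) (shift (shift (dilate S)) (double k))
        ≡⟨ cubic-≡ (dilate-suc-double S k) (dilate-double S k) (shift-dilate-double S k) (shift²-dilate-double S k) ⟩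
      cubic 0# (S k) 0# (shift S k)
        ≈⟨ solve 5 (λ s s₋₁ x y z →
             con 0 :+ (x :+ y) :* s :+ (x :* y :+ z) :* con 0 :+ (x :* z) :* s₋₁
               := (x :+ y) :* s :+ (x :* z) :* s₋₁) refl (S k) (shift S k) x y z ⟩
      a₁ * S k + a₃ * shift S k ∎

    factor-suc : ∀ j → factor (suc j) ≋ dilate (factor j)
    factor-suc j n = sym (trans (dilate-⊛ _ _ n) (⊛-cong dilate-linear dilate-quadratic n))
      where
      dilate-linear : dilate (one ⊕ mono x (2 ^ j)) ≋ one ⊕ mono x (2 ^ suc j)
      dilate-linear k = trans (dilate-⊕ one _ k) (+-cong (dilate-mono 1# 0 k) (dilate-mono x (2 ^ j) k))
      dilate-quadratic : dilate (one ⊕ (mono y (2 ^ j) ⊕ mono z (2 ℕ.* 2 ^ j))) ≋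
                         one ⊕ (mono y (2 ^ suc j) ⊕ mono z (2 ℕ.* 2 ^ suc j))
      dilate-quadratic k = trans (dilate-⊕ one _ k) (+-cong (dilate-mono 1# 0 k)
        (trans (dilate-⊕ _ _ k) (+-cong (dilate-mono y (2 ^ j) k) (dilate-mono z (2 ℕ.* 2 ^ j) k))))

    partialProd-suc : ∀ m → partialProd (suc m) ≋ factor 0 ⊛ dilate (partialProd m)
    partialProd-suc zero n = begin
      (one ⊛ factor 0) n         ≈⟨ ⊛-identityˡ (factor 0) n ⟩
      factor 0 n                 ≈⟨ ⊛-identityʳ (factor 0) n ⟨
      (factor 0 ⊛ one) n         ≈⟨ ⊛-cong (λ _ → refl) (dilate-mono 1# 0) n ⟨
      (factor 0 ⊛ dilate one) n ∎
    partialProd-suc (suc m) n = begin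
      (partialProd (suc m) ⊛ factor (suc m)) n
        ≈⟨ ⊛-cong (partialProd-suc m) (factor-suc m) n ⟩
      ((factor 0 ⊛ dilate (partialProd m)) ⊛ dilate (factor m)) n
        ≈⟨ ⊛-assoc (factor 0) (dilate (partialProd m)) (dilate (factor m)) n ⟩
      (factor 0 ⊛ (dilate (partialProd m) ⊛ dilate (factor m))) n
        ≈⟨ ⊛-cong (λ _ → refl) (dilate-⊛ (partialProd m) (factor m)) n ⟨
      (factor 0 ⊛ dilate (partialProd (suc m))) n ∎

    partialProd-even : ∀ m k → partialProd (suc m) (double k) ≈ partialProd m k + a₂ * shift (partialProd m) k
    partialProd-even m k = trans (partialProd-suc m (double k)) (factor₀-⊛-dilate-even (partialProd m) k)

    partialProd-odd : ∀ m k → partialProd (suc m) (suc (double k)) ≈ a₁ * partialProd m k + a₃ * shift (partialProd m) k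
    partialProd-odd m k = trans (partialProd-suc m (suc (double k))) (factor₀-⊛-dilate-odd (partialProd m) k)

    -- Coefficients of dilate S below 2N only involve S below N, so through
    -- partialProd-suc agreement up to m propagates to agreement up to m + 1.
    partialProd-suc-stable : ∀ m n → n ≤ m → partialProd (suc m) n ≈ partialProd m n
    partialProd-suc-stable zero .zero z≤n =
      trans (partialProd-even 0 0) (trans (+-congˡ (zeroʳ a₂)) (+-identityʳ _))
    partialProd-suc-stable (suc m) n n≤1+m = begin
      partialProd (suc (suc m)) n                ≈⟨ partialProd-suc (suc m) n ⟩
      (factor 0 ⊛ dilate (partialProd (suc m))) n ≈⟨ ⊛-congˡ-≤ (factor 0) n (λ k k≤n →
                                                     dilate-cong-< (suc m) (λ j j<1+m →
                                                       partialProd-suc-stable m j (ℕ.s≤s⁻¹ j<1+m))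
                                                     k (s≤s (≤-trans k≤n (≤-trans n≤1+m (s≤s (n≤double m)))))) ⟩
      (factor 0 ⊛ dilate (partialProd m)) n     ≈⟨ partialProd-suc m n ⟨
      partialProd (suc m) n ∎

    partialProd-stable : ∀ {m n} → n ≤ m → partialProd m n ≈ p n
    partialProd-stable n≤m = go (≤⇒≤′ n≤m)
      where
      go : ∀ {m n} → n ≤′ m → partialProd m n ≈ p n
      go {n = n} ≤′-refl  = sym (partialProd-suc-stable n n ≤-refl)
      go (≤′-step n≤′m)   = trans (partialProd-suc-stable _ _ (≤′⇒≤ n≤′m)) (go n≤′m)

    shift-partialProd-stable : ∀ {m n} → n ≤ m → shift (partialProd m) n ≈ shift p n
    shift-partialProd-stable {n = zero}  _    = refl
    shift-partialProd-stable {n = suc n} n<m = partialProd-stable (≤-trans (n≤1+n n) n<m)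

    p-zero : p 0 ≈ 1#
    p-zero = partialProd-suc-stable 0 0 z≤n

    p-even : ∀ k → p (double k) ≈ p k + a₂ * shift p k
    p-even k = trans (partialProd-even (double k) k)
      (+-cong (partialProd-stable (n≤double k)) (*-congˡ (shift-partialProd-stable (n≤double k))))

    p-odd : ∀ k → p (suc (double k)) ≈ a₁ * p k + a₃ * shift p k
    p-odd k = trans (partialProd-odd (suc (double k)) k)
      (+-cong (*-congˡ (partialProd-stable k≤)) (*-congˡ (shift-partialProd-stable k≤)))
      where
      k≤ = m≤n⇒m≤1+n (n≤double k)

    shift-p≡shift-Q : ∀ n → shift p (2 ^ n ∸ 1) ≡ shift Q n
    shift-p≡shift-Q zero    = ≡.refl
    shift-p≡shift-Q (suc n) = ≡.trans (≡.cong (λ i → shift p (i ∸ 1)) (2^suc≡2+double n))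
                                      (≡.cong (λ i → p (i ∸ 2)) (≡.sym (2^suc≡2+double n)))

    Q-step : ∀ n → Q n ≈ Rs n + a₂ * shift Q n
    Q-step n = begin
      p (2 ^ suc n ∸ 2)                          ≡⟨ ≡.cong (λ i → p (i ∸ 2)) (2^suc≡2+double n) ⟩
      p (double (2 ^ n ∸ 1))                     ≈⟨ p-even (2 ^ n ∸ 1) ⟩
      Rs n + a₂ * shift p (2 ^ n ∸ 1)            ≡⟨ ≡.cong (λ t → Rs n + a₂ * t) (shift-p≡shift-Q n) ⟩
      Rs n + a₂ * shift Q n ∎

    Rs-step : ∀ n → Rs (suc n) ≈ a₁ * Rs n + a₃ * shift Q n
    Rs-step n = begin
      p (2 ^ suc n ∸ 1)                          ≡⟨ ≡.cong (λ i → p (i ∸ 1)) (2^suc≡2+double n) ⟩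
      p (suc (double (2 ^ n ∸ 1)))               ≈⟨ p-odd (2 ^ n ∸ 1) ⟩
      a₁ * Rs n + a₃ * shift p (2 ^ n ∸ 1)       ≡⟨ ≡.cong (λ t → a₁ * Rs n + a₃ * t) (shift-p≡shift-Q n) ⟩
      a₁ * Rs n + a₃ * shift Q n ∎

    Rs-second-order : ∀ n → Rs (suc (suc n)) + c₂ * Rs n ≈ c₁ * Rs (suc n)
    Rs-second-order n = trans
      (coupled⇒second-order Rs (shift Q) det Rs-step
        (λ n → trans (Q-step n) (+-congʳ (sym (*-identityˡ _)))) n)
      (*-congʳ trace)
      where
      det : c₂ + a₃ * 1# ≈ a₁ * a₂
      det = solve 3 (λ x y z → x :* x :* y :+ x :* y :* y :+ y :* z :+ (x :* z) :* con 1
                                 := (x :+ y) :* (x :* y :+ z)) refl x y z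
      trace : a₁ + a₂ ≈ c₁
      trace = solve 3 (λ x y z → (x :+ y) :+ (x :* y :+ z) := x :* y :+ x :+ y :+ z) refl x y z

    Q-second-order : ∀ n → Q (suc (suc n)) + c₂ * Q n ≈ c₁ * Q (suc n)
    Q-second-order n = trans
      (coupled⇒second-order (shift Q) Rs det
        (λ n → trans (Q-step n) (solve 5 (λ r s x y z →
                 r :+ (x :* y :+ z) :* s := (x :* y :+ z) :* s :+ con 1 :* r) refl (Rs n) (shift Q n) x y z))
        (λ n → trans (Rs-step n) (+-comm _ _)) (suc n))
      (*-congʳ trace)
      where
      det : c₂ + 1# * a₃ ≈ a₂ * a₁
      det = solve 3 (λ x y z → x :* x :* y :+ x :* y :* y :+ y :* z :+ con 1 :* (x :* z)
                                 := (x :* y :+ z) :* (x :+ y)) refl x y z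
      trace : a₂ + a₁ ≈ c₁
      trace = solve 3 (λ x y z → (x :* y :+ z) :+ (x :+ y) := x :* y :+ x :+ y :+ z) refl x y z

    Den-⊛-Q : Den ⊛ Q ≋ one
    Den-⊛-Q zero = trans (quadratic-⊛ (- c₁) c₂ Q 0) (u+w≈cv+t⇒u+[-cv+w]≈t
      (trans (+-congʳ p-zero) (solve 3 (λ c d o → o :+ d :* con 0 := c :* con 0 :+ o) refl c₁ c₂ 1#)))
    Den-⊛-Q (suc zero) = trans (quadratic-⊛ (- c₁) c₂ Q 1) (u+w≈cv+t⇒u+[-cv+w]≈t (begin
      Q 1 + c₂ * 0#                          ≈⟨ +-congʳ (trans (Q-step 1) (+-congʳ (Rs-step 0))) ⟩
      a₁ * p 0 + a₃ * 0# + a₂ * p 0 + c₂ * 0# ≈⟨ solve 4 (λ p₀ x y z →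
        (x :+ y) :* p₀ :+ (x :* z) :* con 0 :+ (x :* y :+ z) :* p₀ :+ (x :* x :* y :+ x :* y :* y :+ y :* z) :* con 0
          := (x :* y :+ x :+ y :+ z) :* p₀ :+ con 0) refl (p 0) x y z ⟩
      c₁ * Q 0 + 0# ∎))
    Den-⊛-Q (suc (suc n)) = trans (quadratic-⊛ (- c₁) c₂ Q (suc (suc n)))
      (u+w≈cv+t⇒u+[-cv+w]≈t (trans (Q-second-order n) (sym (+-identityʳ _))))

    Den-⊛-Rs : Den ⊛ Rs ≋ NumR
    Den-⊛-Rs zero = trans (quadratic-⊛ (- c₁) c₂ Rs 0) (u+w≈cv+t⇒u+[-cv+w]≈t
      (trans (+-congʳ p-zero) (solve 3 (λ c d o → o :+ d :* con 0 := c :* con 0 :+ (o :+ con 0)) refl c₁ c₂ 1#)))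
    Den-⊛-Rs (suc zero) = trans (quadratic-⊛ (- c₁) c₂ Rs 1) (u+w≈cv+t⇒u+[-cv+w]≈t (begin
      Rs 1 + c₂ * 0#                        ≈⟨ +-congʳ (trans (Rs-step 0) (+-cong (*-congˡ p-zero) (zeroʳ a₃))) ⟩
      a₁ * 1# + 0# + c₂ * 0#                ≈⟨ +-congʳ (+-congˡ (-‿inverseʳ a₂)) ⟨
      a₁ * 1# + (a₂ + - a₂) + c₂ * 0#       ≈⟨ solve 4 (λ m x y z →
        (x :+ y) :* con 1 :+ ((x :* y :+ z) :+ m) :+ (x :* x :* y :+ x :* y :* y :+ y :* z) :* con 0
          := (x :* y :+ x :+ y :+ z) :* con 1 :+ (con 0 :+ m)) refl (- a₂) x y z ⟩
      c₁ * 1# + (0# + - a₂)                 ≈⟨ +-congʳ (*-congˡ p-zero) ⟨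
      c₁ * Rs 0 + (0# + - a₂) ∎))
    Den-⊛-Rs (suc (suc n)) = trans (quadratic-⊛ (- c₁) c₂ Rs (suc (suc n)))
      (u+w≈cv+t⇒u+[-cv+w]≈t (trans (Rs-second-order n) (sym (trans (+-congˡ (+-identityʳ 0#)) (+-identityʳ _)))))

proposition3p2 : ∀ {c ℓ : Level} (R : CommutativeRing c ℓ) →
    let open PS R in
    (x y z : CommutativeRing.Carrier R) →
    let open Gen x y z in
    (∀ (n : ℕ) → CommutativeRing._≈_ R ((Den ⊛ Q) n) (one n))
    × (∀ (n : ℕ) → CommutativeRing._≈_ R ((Den ⊛ Rs) n) (NumR n))
proposition3p2 R x y z = Den-⊛-Q , Den-⊛-Rs
  where open PowerSeries.Generating R x y z
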